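{- Let $n, r$ be positive integers and let $\alpha \colon \mathbb{F}_2^n \times \mathbb{F}_2^n \to \mathbb{F}_2^r$ be a bilinear map such that for every non-zero $\lambda \in \mathbb{F}_2^r$ the bilinear form $\lambda \cdot \alpha \colon \mathbb{F}_2^n \times \mathbb{F}_2^n \to \mathbb{F}_2$ has rank at least $m$. Let $C$ be a coset of a subspace of $\mathbb{F}_2^n$ of codimension $d$, and let $\varepsilon > 0$. If $m > 4r + 8d + 4\log_2 \varepsilon^{ -1}$, then for every $u \in \mathbb{F}_2^r$ the number of pairs $(x,y) \in C \times C$ with $\alpha(x,y) = u$ is at least $(1-\varepsilon)2^{ -r}|C|^2$. In particular, if $m > 4r + 8d + 4$, then $\alpha|_{C \times C}$ is surjective onto $\mathbb{F}_2^r$.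
   Context: The rank of a bilinear form $\beta \colon U \times V \to \mathbb{F}_2$ is the rank of the linear map $B \colon U \to V$ with $\beta(x,y) = B(x)\cdot y$ for a fixed scalar product on $V$; equivalently, the least $s$ such that $\beta(x,y) = \sum_{i=1}^s u_i(x) v_i(y)$ for linear forms $u_i, v_i$. Here $\lambda\cdot\alpha(x,y) = \sum_{i=1}^r \lambda_i \alpha(x,y)_i$.
   Formalization: The parameter ε ranges over the positive rationals. -}

module Defs where

open import Data.Bool using (Bool; true; false; _xor_; _∧_; if_then_else_)
import Data.Bool.Properties as BoolP
open import Data.Nat using (ℕ; zero; suc; _≤_)
open import Data.Vec using (Vec; []; _∷_; replicate; zipWith; foldr)
open import Data.Vec.Properties using (≡-dec)
open import Data.List using (List; []; _∷_; map; _++_; length; filterᵇ; cartesianProduct)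
open import Data.Bool.ListAction using (any)
open import Data.Product using (Σ; _×_; _,_; proj₁; proj₂)
open import Relation.Nullary.Decidable using (⌊_⌋; Dec)
open import Relation.Binary.PropositionalEquality using (_≡_)

-- F₂ is modelled by Bool: addition = xor, multiplication = ∧.
-- 𝔽₂ⁿ is modelled by Vec Bool n.
V : ℕ → Set
V n = Vec Bool n

_≟V_ : ∀ {n} (x y : V n) → Dec (x ≡ y)
_≟V_ = ≡-dec BoolP._≟_

_⊕_ : ∀ {n} → V n → V n → V n
_⊕_ = zipWith _xor_

𝟎 : ∀ {n} → V n
𝟎 = replicate _ false

dot : ∀ {n} → V n → V n → Bool
dot x y = foldr _ _xor_ false (zipWith _∧_ x y)

allVecs : (n : ℕ) → List (V n)
allVecs zero = [] ∷ []
allVecs (suc n) = map (false ∷_) (allVecs n) ++ map (true ∷_) (allVecs n)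

count : ∀ {A : Set} → (A → Bool) → List A → ℕ
count p xs = length (filterᵇ p xs)

-- bilinearity (over 𝔽₂, additivity in each argument is linearity)
Bilinear : ∀ {n k} → (V n → V n → V k) → Set
Bilinear {n} α =
  (∀ (x x' y : V n) → α (x ⊕ x') y ≡ α x y ⊕ α x' y) ×
  (∀ (x y y' : V n) → α x (y ⊕ y') ≡ α x y ⊕ α x y')

sumProd : ∀ {n s} → Vec (V n) s → Vec (V n) s → V n → V n → Bool
sumProd us vs x y = foldr _ _xor_ false (zipWith (λ u v → dot u x ∧ dot v y) us vs)

HasDecomp : ∀ {n} → (V n → V n → Bool) → ℕ → Set
HasDecomp {n} β s = Σ (Vec (V n) s) λ us → Σ (Vec (V n) s) λ vs →
  ∀ (x y : V n) → β x y ≡ sumProd us vs x y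

-- rank β ≥ m : every decomposition uses at least m terms (rank = least such s)
RankAtLeast : ∀ {n} → (V n → V n → Bool) → ℕ → Set
RankAtLeast β m = ∀ s → HasDecomp β s → m ≤ s

lamDot : ∀ {n r} → V r → (V n → V n → V r) → V n → V n → Bool
lamDot l α x y = dot l (α x y)

combo : ∀ {n k} → Vec (V n) k → V k → V n
combo [] [] = 𝟎
combo (b ∷ bs) (c ∷ cs) = (if c then b else 𝟎) ⊕ combo bs cs

LinIndep : ∀ {n k} → Vec (V n) k → Set
LinIndep {n} {k} bs = ∀ (c : V k) → combo bs c ≡ 𝟎 → c ≡ 𝟎

inSpan : ∀ {n k} → Vec (V n) k → V n → Bool
inSpan {n} {k} bs x = any (λ c → ⌊ combo bs c ≟V x ⌋) (allVecs k)

inCoset : ∀ {n k} → Vec (V n) k → V n → V n → Bool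
inCoset bs a x = inSpan bs (x ⊕ a)

cosetSize : ∀ {n k} → Vec (V n) k → V n → ℕ
cosetSize {n} bs a = count (inCoset bs a) (allVecs n)

pairCount : ∀ {n k r} → (V n → V n → V r) → Vec (V n) k → V n → V r → ℕ
pairCount {n} α bs a u =
  count (λ p → inCoset bs a (proj₁ p) ∧ inCoset bs a (proj₂ p) ∧ ⌊ α (proj₁ p) (proj₂ p) ≟V u ⌋)
        (cartesianProduct (allVecs n) (allVecs n))

{-# OPTIONS --safe #-}
module Submission where

-- For fixed x, the number of y ∈ C with α(x, y) = u is 2⁻ʳ Σₗ Σ_{y ∈ C} (-1)^(l · (α(x, y) + u)). The term
-- l = 0 is |C|, and a term with l ≠ 0 vanishes unless x annihilates the direction space W = span bs of C
-- with respect to l · α: otherwise translating y by some w ∈ W with l · α(x, w) = 1 flips every sign.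
-- Retractions x ↦ x + E x onto that annihilator A and y ↦ y + F y onto W give
-- l · α(x, y) = l · α(E x, y) + l · α(x + E x, F y), a decomposition into codim A + codim W rank-one forms,
-- so the rank hypothesis forces |A| ≤ 2^(n + d + 1 - m). Summing over x ∈ C and l ≠ 0, the error term is
-- at most |C| · 2^(r + n + d + 1 - m) ≤ ε |C|² as soon as 2^(r + 2d + 1) ≤ ε 2^m, which the hypothesis implies.

open import Defs
open import Algebra.Bundles using (CommutativeRing)
import Algebra.Properties.CommutativeSemigroup as CommutativeSemigroupProperties
open import Data.Bool using (Bool; true; false; not; _∧_; _xor_; if_then_else_)
open import Data.Bool.ListAction using (any)
open import Data.Bool.Properties
  using ( T-≡; ⇔→≡; not-injective; ∧-comm; ∧-zeroʳ; ∧-identityʳ; ∧-distribˡ-xor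
        ; xor-assoc; xor-comm; xor-identityʳ; xor-same; xor-∧-commutativeRing)
open import Data.Empty using (⊥; ⊥-elim)
open import Data.List using (List; []; _∷_; map; cartesianProduct)
import Data.List as List
open import Data.List.Membership.Propositional using (_∈_)
open import Data.List.Membership.Propositional.Properties using (∈-map⁺; ∈-++⁺ˡ; ∈-++⁺ʳ)
open import Data.List.Properties using (map-++; map-∘; map-cong)
open import Data.List.Relation.Unary.Any using (here; satisfied)
import Data.List.Relation.Unary.Any as Any
open import Data.List.Relation.Unary.Any.Properties using (any⁺; any⁻)
open import Data.Nat using (ℕ; zero; suc; pred; _+_; _*_; _∸_; _^_; _≤_; _<_; _≤?_; z≤n; s≤s)
open import Data.Nat.ListAction using (sum)
open import Data.Nat.ListAction.Properties using (sum-++)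
open import Data.Nat.Properties
open import Data.Nat.Solver using (module +-*-Solver)
open import Data.Product using (Σ; ∃; _×_; _,_; proj₂)
import Data.Product as Product
open import Data.Vec using (Vec; []; _∷_; _++_)
import Data.Vec as Vec
open import Data.Vec.Properties
  using (∷-injectiveˡ; ∷-injectiveʳ; zipWith-assoc; zipWith-comm; zipWith-identityˡ; zipWith-identityʳ)
import Data.Vec.Properties as Vecₚ
open import Function using (_∘_; flip)
open import Function.Bundles using (Equivalence; mk⇔)
open import Relation.Binary.PropositionalEquality
open import Relation.Nullary using (yes; no; contradiction)
open import Relation.Nullary.Decidable using (⌊_⌋; isYes≗does; dec-true; toWitness)

open Equivalence using (to; from)
open +-*-Solver using (solve; _:+_; _:*_; _:=_; con)
open CommutativeSemigroupProperties (CommutativeRing.+-commutativeSemigroup xor-∧-commutativeRing)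
  using () renaming (interchange to xor-interchange)
open CommutativeSemigroupProperties +-commutativeSemigroup using () renaming (interchange to +-interchange)


⊕-assoc : ∀ {n} (x y z : V n) → (x ⊕ y) ⊕ z ≡ x ⊕ (y ⊕ z)
⊕-assoc = zipWith-assoc xor-assoc

⊕-comm : ∀ {n} (x y : V n) → x ⊕ y ≡ y ⊕ x
⊕-comm = zipWith-comm xor-comm

⊕-identityˡ : ∀ {n} (x : V n) → 𝟎 ⊕ x ≡ x
⊕-identityˡ = zipWith-identityˡ λ _ → refl

⊕-identityʳ : ∀ {n} (x : V n) → x ⊕ 𝟎 ≡ x
⊕-identityʳ = zipWith-identityʳ xor-identityʳ

⊕-self : ∀ {n} (x : V n) → x ⊕ x ≡ 𝟎
⊕-self []      = refl
⊕-self (a ∷ x) = cong₂ _∷_ (xor-same a) (⊕-self x)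

⊕-cancelʳ : ∀ {n} (x y : V n) → (x ⊕ y) ⊕ y ≡ x
⊕-cancelʳ x y = begin
  (x ⊕ y) ⊕ y ≡⟨ ⊕-assoc x y y ⟩
  x ⊕ (y ⊕ y) ≡⟨ cong (x ⊕_) (⊕-self y) ⟩
  x ⊕ 𝟎       ≡⟨ ⊕-identityʳ x ⟩
  x           ∎
  where open ≡-Reasoning

⊕-cancelˡ : ∀ {n} (x y : V n) → x ⊕ (x ⊕ y) ≡ y
⊕-cancelˡ x y = begin
  x ⊕ (x ⊕ y) ≡⟨ ⊕-assoc x x y ⟨
  (x ⊕ x) ⊕ y ≡⟨ cong (_⊕ y) (⊕-self x) ⟩
  𝟎 ⊕ y       ≡⟨ ⊕-identityˡ y ⟩
  y           ∎
  where open ≡-Reasoning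

⊕-interchange : ∀ {n} (w x y z : V n) → (w ⊕ x) ⊕ (y ⊕ z) ≡ (w ⊕ y) ⊕ (x ⊕ z)
⊕-interchange []      []      []      []      = refl
⊕-interchange (a ∷ w) (b ∷ x) (c ∷ y) (d ∷ z) = cong₂ _∷_ (xor-interchange a b c d) (⊕-interchange w x y z)

⊕≡𝟎⇒≡ : ∀ {n} (x y : V n) → x ⊕ y ≡ 𝟎 → x ≡ y
⊕≡𝟎⇒≡ x y x⊕y≡𝟎 = begin
  x             ≡⟨ ⊕-cancelʳ x y ⟨
  (x ⊕ y) ⊕ y   ≡⟨ cong (_⊕ y) x⊕y≡𝟎 ⟩
  𝟎 ⊕ y         ≡⟨ ⊕-identityˡ y ⟩
  y             ∎
  where open ≡-Reasoning

≟V-complete : ∀ {n} {x y : V n} → x ≡ y → ⌊ x ≟V y ⌋ ≡ true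
≟V-complete {x = x} {y} x≡y = trans (isYes≗does (x ≟V y)) (dec-true (x ≟V y) x≡y)

≟V-sound : ∀ {n} {x y : V n} → ⌊ x ≟V y ⌋ ≡ true → x ≡ y
≟V-sound e = toWitness (T-≡ .from e)

dot-⊕ʳ : ∀ {n} (u x y : V n) → dot u (x ⊕ y) ≡ dot u x xor dot u y
dot-⊕ʳ []      []      []      = refl
dot-⊕ʳ (c ∷ u) (a ∷ x) (b ∷ y) = begin
  (c ∧ (a xor b)) xor dot u (x ⊕ y)                 ≡⟨ cong₂ _xor_ (∧-distribˡ-xor c a b) (dot-⊕ʳ u x y) ⟩
  ((c ∧ a) xor (c ∧ b)) xor (dot u x xor dot u y)   ≡⟨ xor-interchange (c ∧ a) (c ∧ b) (dot u x) (dot u y) ⟩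
  ((c ∧ a) xor dot u x) xor ((c ∧ b) xor dot u y)   ∎
  where open ≡-Reasoning

dot-𝟎ˡ : ∀ {n} (x : V n) → dot 𝟎 x ≡ false
dot-𝟎ˡ []      = refl
dot-𝟎ˡ (a ∷ x) = dot-𝟎ˡ x

dot-𝟎ʳ : ∀ {n} (u : V n) → dot u 𝟎 ≡ false
dot-𝟎ʳ []      = refl
dot-𝟎ʳ (c ∷ u) = cong₂ _xor_ (∧-zeroʳ c) (dot-𝟎ʳ u)

Additive : ∀ {n} → (V n → Bool) → Set
Additive f = ∀ x y → f (x ⊕ y) ≡ f x xor f y

additive-𝟎 : ∀ {n} (f : V n → Bool) → Additive f → f 𝟎 ≡ false
additive-𝟎 f f-add = begin
  f 𝟎             ≡⟨ cong f (⊕-self 𝟎) ⟨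
  f (𝟎 ⊕ 𝟎)       ≡⟨ f-add 𝟎 𝟎 ⟩
  f 𝟎 xor f 𝟎     ≡⟨ xor-same (f 𝟎) ⟩
  false           ∎
  where open ≡-Reasoning

represent : ∀ {n} → (V n → Bool) → V n
represent {zero}  f = []
represent {suc n} f = f (true ∷ 𝟎) ∷ represent (f ∘ (false ∷_))

dot-represent : ∀ {n} (f : V n → Bool) → Additive f → ∀ x → dot (represent f) x ≡ f x
dot-represent {zero}  f f-add []      = sym (additive-𝟎 f f-add)
dot-represent {suc n} f f-add (b ∷ x) = begin
  (f (true ∷ 𝟎) ∧ b) xor dot (represent (f ∘ (false ∷_))) x
    ≡⟨ cong₂ _xor_ (head-coefficient b) (dot-represent (f ∘ (false ∷_)) (λ y z → f-add (false ∷ y) (false ∷ z)) x) ⟩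
  f (b ∷ 𝟎) xor f (false ∷ x)   ≡⟨ f-add (b ∷ 𝟎) (false ∷ x) ⟨
  f ((b ∷ 𝟎) ⊕ (false ∷ x))     ≡⟨ cong f (cong₂ _∷_ (xor-identityʳ b) (⊕-identityˡ x)) ⟩
  f (b ∷ x)                     ∎
  where
  open ≡-Reasoning
  head-coefficient : ∀ b → f (true ∷ 𝟎) ∧ b ≡ f (b ∷ 𝟎)
  head-coefficient true  = ∧-identityʳ (f (true ∷ 𝟎))
  head-coefficient false = trans (∧-zeroʳ _) (sym (additive-𝟎 f f-add))


ind : Bool → ℕ
ind true  = 1
ind false = 0

ind-∧ : ∀ a b → ind (a ∧ b) ≡ ind a * ind b
ind-∧ true  b = sym (+-identityʳ (ind b))
ind-∧ false b = refl

ind≤1 : ∀ b → ind b ≤ 1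
ind≤1 true  = ≤-refl
ind≤1 false = z≤n

ind-+-≤ : ∀ {P Q R : Bool} → (P ≡ true → R ≡ true) → (Q ≡ true → R ≡ true) →
  (P ≡ true → Q ≡ true → ⊥) → ind P + ind Q ≤ ind R
ind-+-≤ {true}  {true}  p⇒r q⇒r disjoint = ⊥-elim (disjoint refl refl)
ind-+-≤ {true}  {false} p⇒r q⇒r _ = ≤-reflexive (cong ind (sym (p⇒r refl)))
ind-+-≤ {false} {true}  p⇒r q⇒r _ = ≤-reflexive (cong ind (sym (q⇒r refl)))
ind-+-≤ {false} {false} p⇒r q⇒r _ = z≤n

∧-≡-true : ∀ {a b} → a ∧ b ≡ true → a ≡ true × b ≡ true
∧-≡-true {true} b≡true = refl , b≡true

Σᵥ : ∀ n → (V n → ℕ) → ℕ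
Σᵥ zero    f = f []
Σᵥ (suc n) f = Σᵥ n (f ∘ (false ∷_)) + Σᵥ n (f ∘ (true ∷_))

Σᵥ-cong : ∀ n {f g : V n → ℕ} → (∀ x → f x ≡ g x) → Σᵥ n f ≡ Σᵥ n g
Σᵥ-cong zero    f≗g = f≗g []
Σᵥ-cong (suc n) f≗g = cong₂ _+_ (Σᵥ-cong n (f≗g ∘ (false ∷_))) (Σᵥ-cong n (f≗g ∘ (true ∷_)))

Σᵥ-mono : ∀ n {f g : V n → ℕ} → (∀ x → f x ≤ g x) → Σᵥ n f ≤ Σᵥ n g
Σᵥ-mono zero    f≤g = f≤g []
Σᵥ-mono (suc n) f≤g = +-mono-≤ (Σᵥ-mono n (f≤g ∘ (false ∷_))) (Σᵥ-mono n (f≤g ∘ (true ∷_)))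

Σᵥ-const : ∀ n c → Σᵥ n (λ _ → c) ≡ 2 ^ n * c
Σᵥ-const zero    c = sym (+-identityʳ c)
Σᵥ-const (suc n) c = begin
  Σᵥ n (λ _ → c) + Σᵥ n (λ _ → c)   ≡⟨ cong₂ _+_ (Σᵥ-const n c) (Σᵥ-const n c) ⟩
  2 ^ n * c + 2 ^ n * c             ≡⟨ cong (2 ^ n * c +_) (+-identityʳ (2 ^ n * c)) ⟨
  2 * (2 ^ n * c)                   ≡⟨ *-assoc 2 (2 ^ n) c ⟨
  2 ^ suc n * c                     ∎
  where open ≡-Reasoning

Σᵥ-+ : ∀ n (f g : V n → ℕ) → Σᵥ n (λ x → f x + g x) ≡ Σᵥ n f + Σᵥ n g
Σᵥ-+ zero    f g = refl
Σᵥ-+ (suc n) f g =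
  trans (cong₂ _+_ (Σᵥ-+ n (f ∘ (false ∷_)) (g ∘ (false ∷_))) (Σᵥ-+ n (f ∘ (true ∷_)) (g ∘ (true ∷_))))
        (+-interchange (Σᵥ n (f ∘ (false ∷_))) (Σᵥ n (g ∘ (false ∷_))) (Σᵥ n (f ∘ (true ∷_))) (Σᵥ n (g ∘ (true ∷_))))

Σᵥ-*ˡ : ∀ n c (f : V n → ℕ) → Σᵥ n (λ x → c * f x) ≡ c * Σᵥ n f
Σᵥ-*ˡ zero    c f = refl
Σᵥ-*ˡ (suc n) c f =
  trans (cong₂ _+_ (Σᵥ-*ˡ n c (f ∘ (false ∷_))) (Σᵥ-*ˡ n c (f ∘ (true ∷_)))) (sym (*-distribˡ-+ c _ _))

Σᵥ-swap : ∀ m n (f : V m → V n → ℕ) → Σᵥ m (λ x → Σᵥ n (f x)) ≡ Σᵥ n (λ y → Σᵥ m (λ x → f x y))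
Σᵥ-swap zero    n f = refl
Σᵥ-swap (suc m) n f =
  trans (cong₂ _+_ (Σᵥ-swap m n (f ∘ (false ∷_))) (Σᵥ-swap m n (f ∘ (true ∷_))))
        (sym (Σᵥ-+ n (λ y → Σᵥ m (λ x → f (false ∷ x) y)) (λ y → Σᵥ m (λ x → f (true ∷ x) y))))

Σᵥ-translate : ∀ n (f : V n → ℕ) (z : V n) → Σᵥ n (λ x → f (x ⊕ z)) ≡ Σᵥ n f
Σᵥ-translate zero    f []          = refl
Σᵥ-translate (suc n) f (false ∷ z) =
  cong₂ _+_ (Σᵥ-translate n (f ∘ (false ∷_)) z) (Σᵥ-translate n (f ∘ (true ∷_)) z)
Σᵥ-translate (suc n) f (true ∷ z)  =
  trans (cong₂ _+_ (Σᵥ-translate n (f ∘ (true ∷_)) z) (Σᵥ-translate n (f ∘ (false ∷_)) z))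
        (+-comm (Σᵥ n (f ∘ (true ∷_))) (Σᵥ n (f ∘ (false ∷_))))

term≤Σᵥ : ∀ n (f : V n → ℕ) x → f x ≤ Σᵥ n f
term≤Σᵥ zero    f []          = ≤-refl
term≤Σᵥ (suc n) f (false ∷ x) = ≤-trans (term≤Σᵥ n (f ∘ (false ∷_)) x) (m≤m+n _ _)
term≤Σᵥ (suc n) f (true ∷ x)  = ≤-trans (term≤Σᵥ n (f ∘ (true ∷_)) x) (m≤n+m _ _)

Σᵥ-ind≤ : ∀ n (p : V n → Bool) → Σᵥ n (ind ∘ p) ≤ 2 ^ n
Σᵥ-ind≤ n p = ≤-trans (Σᵥ-mono n (ind≤1 ∘ p)) (≤-reflexive (trans (Σᵥ-const n 1) (*-identityʳ (2 ^ n))))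

Σᵥ-balanced : ∀ n (Q g : V n → Bool) (w : V n) →
  (∀ y → Q (y ⊕ w) ≡ Q y) → (∀ y → g (y ⊕ w) ≡ not (g y)) →
  2 * Σᵥ n (λ y → ind (Q y ∧ not (g y))) ≡ Σᵥ n (ind ∘ Q)
Σᵥ-balanced n Q g w Q-inv g-flip = begin
  2 * A                                                  ≡⟨ cong (A +_) (+-identityʳ A) ⟩
  A + A                                                  ≡⟨ cong (A +_) shifted ⟨
  A + Σᵥ n (λ y → ind (Q y ∧ g y))                       ≡⟨ Σᵥ-+ n (λ y → ind (Q y ∧ not (g y))) (λ y → ind (Q y ∧ g y)) ⟨
  Σᵥ n (λ y → ind (Q y ∧ not (g y)) + ind (Q y ∧ g y))   ≡⟨ Σᵥ-cong n split ⟩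
  Σᵥ n (ind ∘ Q)                                         ∎
  where
  open ≡-Reasoning
  A = Σᵥ n (λ y → ind (Q y ∧ not (g y)))
  shifted : Σᵥ n (λ y → ind (Q y ∧ g y)) ≡ A
  shifted = trans (sym (Σᵥ-translate n (λ y → ind (Q y ∧ g y)) w))
                  (Σᵥ-cong n (λ y → cong ind (cong₂ _∧_ (Q-inv y) (g-flip y))))
  split : ∀ y → ind (Q y ∧ not (g y)) + ind (Q y ∧ g y) ≡ ind (Q y)
  split y with Q y | g y
  ... | true  | true  = refl
  ... | true  | false = refl
  ... | false | _     = refl

Σᵥ-character-nonzero : ∀ r (v : V r) → v ≢ 𝟎 → Σᵥ r (λ l → 2 * ind (not (dot l v))) ≡ 2 ^ r
Σᵥ-character-nonzero zero    []          []≢𝟎 = ⊥-elim ([]≢𝟎 refl)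
Σᵥ-character-nonzero (suc r) (false ∷ v) v≢𝟎  = begin
  S + S             ≡⟨ cong (S +_) (+-identityʳ S) ⟨
  2 * S             ≡⟨ cong (2 *_) (Σᵥ-character-nonzero r v (v≢𝟎 ∘ cong (false ∷_))) ⟩
  2 ^ suc r         ∎
  where
  open ≡-Reasoning
  S = Σᵥ r (λ l → 2 * ind (not (dot l v)))
Σᵥ-character-nonzero (suc r) (true ∷ v)  _    = begin
  Σᵥ r (λ l → 2 * ind (not (dot l v))) + Σᵥ r (λ l → 2 * ind (not (not (dot l v))))
    ≡⟨ Σᵥ-+ r (λ l → 2 * ind (not (dot l v))) (λ l → 2 * ind (not (not (dot l v)))) ⟨
  Σᵥ r (λ l → 2 * ind (not (dot l v)) + 2 * ind (not (not (dot l v))))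
    ≡⟨ Σᵥ-cong r (λ l → complementary (dot l v)) ⟩
  Σᵥ r (λ _ → 2)    ≡⟨ Σᵥ-const r 2 ⟩
  2 ^ r * 2         ≡⟨ *-comm (2 ^ r) 2 ⟩
  2 ^ suc r         ∎
  where
  open ≡-Reasoning
  complementary : ∀ b → 2 * ind (not b) + 2 * ind (not (not b)) ≡ 2
  complementary true  = refl
  complementary false = refl

Σᵥ-character : ∀ r (v u : V r) →
  Σᵥ r (λ l → 2 * ind (not (dot l (v ⊕ u)))) ≡ 2 ^ r + 2 ^ r * ind ⌊ v ≟V u ⌋
Σᵥ-character r v u with v ≟V u
... | yes refl = begin
  Σᵥ r (λ l → 2 * ind (not (dot l (v ⊕ v))))
    ≡⟨ Σᵥ-cong r (λ l → cong (λ b → 2 * ind (not b)) (trans (cong (dot l) (⊕-self v)) (dot-𝟎ʳ l))) ⟩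
  Σᵥ r (λ _ → 2)            ≡⟨ Σᵥ-const r 2 ⟩
  2 ^ r * (1 + 1)           ≡⟨ *-distribˡ-+ (2 ^ r) 1 1 ⟩
  2 ^ r * 1 + 2 ^ r * 1     ≡⟨ cong (_+ 2 ^ r * 1) (*-identityʳ (2 ^ r)) ⟩
  2 ^ r + 2 ^ r * 1         ∎
  where open ≡-Reasoning
... | no v≢u = begin
  Σᵥ r (λ l → 2 * ind (not (dot l (v ⊕ u))))   ≡⟨ Σᵥ-character-nonzero r (v ⊕ u) (v≢u ∘ ⊕≡𝟎⇒≡ v u) ⟩
  2 ^ r                                         ≡⟨ +-identityʳ (2 ^ r) ⟨
  2 ^ r + 0                                     ≡⟨ cong (2 ^ r +_) (*-zeroʳ (2 ^ r)) ⟨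
  2 ^ r + 2 ^ r * 0                             ∎
  where open ≡-Reasoning


count-as-sum : ∀ {A : Set} (p : A → Bool) xs → count p xs ≡ sum (map (ind ∘ p) xs)
count-as-sum p []       = refl
count-as-sum p (x ∷ xs) with p x
... | true  = cong suc (count-as-sum p xs)
... | false = count-as-sum p xs

count-witness : ∀ {A : Set} (p : A → Bool) xs → 1 ≤ count p xs → ∃ λ z → p z ≡ true
count-witness p (x ∷ xs) pos with p x in px
... | true  = x , px
... | false = count-witness p xs pos

sum-map-++ : ∀ {A : Set} (f : A → ℕ) xs ys → sum (map f (xs List.++ ys)) ≡ sum (map f xs) + sum (map f ys)
sum-map-++ f xs ys = trans (cong sum (map-++ f xs ys)) (sum-++ (map f xs) (map f ys))

sum-allVecs : ∀ n (f : V n → ℕ) → sum (map f (allVecs n)) ≡ Σᵥ n f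
sum-allVecs zero    f = +-identityʳ (f [])
sum-allVecs (suc n) f = begin
  sum (map f (map (false ∷_) (allVecs n) List.++ map (true ∷_) (allVecs n)))
    ≡⟨ sum-map-++ f (map (false ∷_) (allVecs n)) (map (true ∷_) (allVecs n)) ⟩
  sum (map f (map (false ∷_) (allVecs n))) + sum (map f (map (true ∷_) (allVecs n)))
    ≡⟨ cong₂ _+_ (cong sum (map-∘ (allVecs n))) (cong sum (map-∘ (allVecs n))) ⟨
  sum (map (f ∘ (false ∷_)) (allVecs n)) + sum (map (f ∘ (true ∷_)) (allVecs n))
    ≡⟨ cong₂ _+_ (sum-allVecs n (f ∘ (false ∷_))) (sum-allVecs n (f ∘ (true ∷_))) ⟩
  Σᵥ (suc n) f ∎
  where open ≡-Reasoning

sum-cartesianProduct : ∀ {A B : Set} (f : A × B → ℕ) xs (ys : List B) →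
  sum (map f (cartesianProduct xs ys)) ≡ sum (map (λ x → sum (map (λ y → f (x , y)) ys)) xs)
sum-cartesianProduct f []       ys = refl
sum-cartesianProduct f (x ∷ xs) ys = begin
  sum (map f (map (x ,_) ys List.++ cartesianProduct xs ys))
    ≡⟨ sum-map-++ f (map (x ,_) ys) (cartesianProduct xs ys) ⟩
  sum (map f (map (x ,_) ys)) + sum (map f (cartesianProduct xs ys))
    ≡⟨ cong₂ _+_ (cong sum (sym (map-∘ ys))) (sum-cartesianProduct f xs ys) ⟩
  sum (map (λ y → f (x , y)) ys) + sum (map (λ x → sum (map (λ y → f (x , y)) ys)) xs) ∎
  where open ≡-Reasoning

count-allVecs : ∀ n (p : V n → Bool) → count p (allVecs n) ≡ Σᵥ n (ind ∘ p)
count-allVecs n p = trans (count-as-sum p (allVecs n)) (sum-allVecs n (ind ∘ p))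

count-allVecs² : ∀ n (p : V n × V n → Bool) →
  count p (cartesianProduct (allVecs n) (allVecs n)) ≡ Σᵥ n (λ x → Σᵥ n (λ y → ind (p (x , y))))
count-allVecs² n p = begin
  count p (cartesianProduct (allVecs n) (allVecs n))
    ≡⟨ count-as-sum p (cartesianProduct (allVecs n) (allVecs n)) ⟩
  sum (map (ind ∘ p) (cartesianProduct (allVecs n) (allVecs n)))
    ≡⟨ sum-cartesianProduct (ind ∘ p) (allVecs n) (allVecs n) ⟩
  sum (map (λ x → sum (map (λ y → ind (p (x , y))) (allVecs n))) (allVecs n))
    ≡⟨ cong sum (map-cong (λ x → sum-allVecs n (λ y → ind (p (x , y)))) (allVecs n)) ⟩
  sum (map (λ x → Σᵥ n (λ y → ind (p (x , y)))) (allVecs n))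
    ≡⟨ sum-allVecs n (λ x → Σᵥ n (λ y → ind (p (x , y)))) ⟩
  Σᵥ n (λ x → Σᵥ n (λ y → ind (p (x , y)))) ∎
  where open ≡-Reasoning

∈-allVecs : ∀ {n} (x : V n) → x ∈ allVecs n
∈-allVecs []          = here refl
∈-allVecs (false ∷ x) = ∈-++⁺ˡ (∈-map⁺ (false ∷_) (∈-allVecs x))
∈-allVecs {suc n} (true ∷ x) = ∈-++⁺ʳ (map (false ∷_) (allVecs n)) (∈-map⁺ (true ∷_) (∈-allVecs x))

any-allVecs⁺ : ∀ n (p : V n → Bool) x → p x ≡ true → any p (allVecs n) ≡ true
any-allVecs⁺ n p x px = T-≡ .to (any⁺ p (Any.map (λ { refl → T-≡ .from px }) (∈-allVecs x)))

any-allVecs⁻ : ∀ n (p : V n → Bool) → any p (allVecs n) ≡ true → ∃ λ x → p x ≡ true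
any-allVecs⁻ n p e = Product.map₂ (T-≡ .to) (satisfied (any⁻ p (allVecs n) (T-≡ .from e)))

any-allVecs-false : ∀ n (p : V n → Bool) → any p (allVecs n) ≡ false → ∀ x → p x ≡ false
any-allVecs-false n p none x with p x in px
... | false = refl
... | true with trans (sym (any-allVecs⁺ n p x px)) none
...   | ()

any-allVecs-none : ∀ n (p : V n → Bool) → (∀ x → p x ≡ false) → any p (allVecs n) ≡ false
any-allVecs-none n p none with any p (allVecs n) in found
... | false = refl
... | true with any-allVecs⁻ n p found
...   | x , px with trans (sym px) (none x)
...     | ()


scale-xor : ∀ {n} x y (b : V n) → (if x xor y then b else 𝟎) ≡ (if x then b else 𝟎) ⊕ (if y then b else 𝟎)
scale-xor true  true  b = sym (⊕-self b)
scale-xor true  false b = sym (⊕-identityʳ b)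
scale-xor false true  b = sym (⊕-identityˡ b)
scale-xor false false b = sym (⊕-self 𝟎)

combo-⊕ : ∀ {n k} (bs : Vec (V n) k) c c' → combo bs (c ⊕ c') ≡ combo bs c ⊕ combo bs c'
combo-⊕ []       []      []       = sym (⊕-self 𝟎)
combo-⊕ (b ∷ bs) (x ∷ c) (y ∷ c') =
  trans (cong₂ _⊕_ (scale-xor x y b) (combo-⊕ bs c c'))
        (⊕-interchange (if x then b else 𝟎) (if y then b else 𝟎) (combo bs c) (combo bs c'))

inSpan⁺ : ∀ {n k} (bs : Vec (V n) k) c → inSpan bs (combo bs c) ≡ true
inSpan⁺ {k = k} bs c = any-allVecs⁺ k (λ c′ → ⌊ combo bs c′ ≟V combo bs c ⌋) c (≟V-complete refl)

inSpan⁻ : ∀ {n k} (bs : Vec (V n) k) {x} → inSpan bs x ≡ true → ∃ λ c → combo bs c ≡ x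
inSpan⁻ {k = k} bs e = Product.map₂ ≟V-sound (any-allVecs⁻ k _ e)

inSpan-⊕ : ∀ {n k} (bs : Vec (V n) k) {x y} → inSpan bs x ≡ true → inSpan bs y ≡ true → inSpan bs (x ⊕ y) ≡ true
inSpan-⊕ bs x∈ y∈ with inSpan⁻ bs x∈ | inSpan⁻ bs y∈
... | c , refl | c′ , refl = subst (λ v → inSpan bs v ≡ true) (combo-⊕ bs c c′) (inSpan⁺ bs (c ⊕ c′))

inSpan-shift : ∀ {n k} (bs : Vec (V n) k) {w} → inSpan bs w ≡ true → ∀ x → inSpan bs (x ⊕ w) ≡ inSpan bs x
inSpan-shift bs w∈ x = ⇔→≡ (mk⇔
  (λ x⊕w∈ → subst (λ v → inSpan bs v ≡ true) (⊕-cancelʳ x _) (inSpan-⊕ bs x⊕w∈ w∈))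
  (λ x∈ → inSpan-⊕ bs x∈ w∈))

LinIndep-tail : ∀ {n k} {b : V n} {bs : Vec (V n) k} → LinIndep (b ∷ bs) → LinIndep bs
LinIndep-tail {bs = bs} indep c combo≡𝟎 =
  ∷-injectiveʳ (indep (false ∷ c) (trans (⊕-identityˡ (combo bs c)) combo≡𝟎))

-- span (b ∷ bs) contains the disjoint translates span bs and b + span bs
span-size : ∀ {n k} (bs : Vec (V n) k) → LinIndep bs → 2 ^ k ≤ Σᵥ n (ind ∘ inSpan bs)
span-size {n} [] _ = ≤-trans (≤-reflexive (cong ind (sym (inSpan⁺ [] [])))) (term≤Σᵥ n (ind ∘ inSpan []) 𝟎)
span-size {n} {suc k} (b ∷ bs) indep = begin
  2 * 2 ^ k                       ≤⟨ *-monoʳ-≤ 2 (span-size bs (LinIndep-tail indep)) ⟩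
  2 * S                           ≡⟨ cong (S +_) (+-identityʳ S) ⟩
  S + S                           ≡⟨ cong (S +_) (Σᵥ-translate n (ind ∘ inSpan bs) b) ⟨
  S + Σᵥ n (λ x → ind (inSpan bs (x ⊕ b)))
    ≡⟨ Σᵥ-+ n (ind ∘ inSpan bs) (λ x → ind (inSpan bs (x ⊕ b))) ⟨
  Σᵥ n (λ x → ind (inSpan bs x) + ind (inSpan bs (x ⊕ b)))
    ≤⟨ Σᵥ-mono n (λ x → ind-+-≤ (unshifted x) (shifted x) (disjoint x)) ⟩
  Σᵥ n (ind ∘ inSpan (b ∷ bs))    ∎
  where
  open ≤-Reasoning
  S = Σᵥ n (ind ∘ inSpan bs)
  unshifted : ∀ x → inSpan bs x ≡ true → inSpan (b ∷ bs) x ≡ true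
  unshifted x x∈ with inSpan⁻ bs x∈
  ... | c , refl = subst (λ v → inSpan (b ∷ bs) v ≡ true) (⊕-identityˡ (combo bs c)) (inSpan⁺ (b ∷ bs) (false ∷ c))
  shifted : ∀ x → inSpan bs (x ⊕ b) ≡ true → inSpan (b ∷ bs) x ≡ true
  shifted x x⊕b∈ with inSpan⁻ bs x⊕b∈
  ... | c , c↦x⊕b = subst (λ v → inSpan (b ∷ bs) v ≡ true) b⊕[x⊕b]≡x (inSpan⁺ (b ∷ bs) (true ∷ c))
    where
    b⊕[x⊕b]≡x : b ⊕ combo bs c ≡ x
    b⊕[x⊕b]≡x = trans (cong (b ⊕_) c↦x⊕b) (trans (⊕-comm b (x ⊕ b)) (⊕-cancelʳ x b))
  disjoint : ∀ x → inSpan bs x ≡ true → inSpan bs (x ⊕ b) ≡ true → ⊥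
  disjoint x x∈ x⊕b∈ with inSpan⁻ bs (inSpan-⊕ bs x∈ x⊕b∈)
  ... | c , c↦x⊕[x⊕b]
    with ∷-injectiveˡ (indep (true ∷ c) (trans (cong (b ⊕_) (trans c↦x⊕[x⊕b] (⊕-cancelˡ x b))) (⊕-self b)))
  ... | ()

inCoset-shift : ∀ {n k} (bs : Vec (V n) k) (a : V n) {w} → inSpan bs w ≡ true →
  ∀ y → inCoset bs a (y ⊕ w) ≡ inCoset bs a y
inCoset-shift bs a {w} w∈ y = trans (cong (inSpan bs) swapped) (inSpan-shift bs w∈ (y ⊕ a))
  where
  swapped : (y ⊕ w) ⊕ a ≡ (y ⊕ a) ⊕ w
  swapped = trans (⊕-assoc y w a) (trans (cong (y ⊕_) (⊕-comm w a)) (sym (⊕-assoc y a w)))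

coset-size : ∀ {n k} (bs : Vec (V n) k) (a : V n) → LinIndep bs → 2 ^ k ≤ Σᵥ n (ind ∘ inCoset bs a)
coset-size {n} bs a indep = ≤-trans (span-size bs indep) (≤-reflexive (sym (Σᵥ-translate n (ind ∘ inSpan bs) a)))


pow₂-cancel-≤ : ∀ {m n} → 2 ^ m ≤ 2 ^ n → m ≤ n
pow₂-cancel-≤ 2^m≤2^n = ≮⇒≥ (λ n<m → <⇒≱ (^-monoʳ-< 2 (s≤s (s≤s z≤n)) n<m) 2^m≤2^n)

pow₂-halve : ∀ t {a} → 2 ^ t ≤ 2 * a → 2 ^ pred t ≤ a
pow₂-halve zero    {zero}  ()
pow₂-halve zero    {suc a} _  = s≤s z≤n
pow₂-halve (suc t)         le = *-cancelˡ-≤ 2 le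

binary-magnitude : ∀ N K → 1 ≤ K → K < 2 ^ N → ∃ λ t → 2 ^ t ≤ K × K < 2 ^ suc t
binary-magnitude zero    K 1≤K K<1 = ⊥-elim (<⇒≱ K<1 1≤K)
binary-magnitude (suc N) K 1≤K K<2^[1+N] with 2 ^ N ≤? K
... | yes 2^N≤K = N , 2^N≤K , K<2^[1+N]
... | no  2^N≰K = binary-magnitude N K 1≤K (≰⇒> 2^N≰K)


-- Low-rank retractions onto subspaces

Closed : ∀ {n} → (V n → Bool) → Set
Closed P = ∀ {x y} → P x ≡ true → P y ≡ true → P (x ⊕ y) ≡ true

coefficients : ∀ {n s} → Vec (V n) s → V n → V s
coefficients us x = Vec.map (λ u → dot u x) us

lowRank : ∀ {n s} → Vec (V n) s → Vec (V n) s → V n → V n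
lowRank us es x = combo es (coefficients us x)

coefficients-⊕ : ∀ {n s} (us : Vec (V n) s) x y → coefficients us (x ⊕ y) ≡ coefficients us x ⊕ coefficients us y
coefficients-⊕ []       x y = refl
coefficients-⊕ (u ∷ us) x y = cong₂ _∷_ (dot-⊕ʳ u x y) (coefficients-⊕ us x y)

lowRank-⊕ : ∀ {n s} (us es : Vec (V n) s) x y → lowRank us es (x ⊕ y) ≡ lowRank us es x ⊕ lowRank us es y
lowRank-⊕ us es x y = trans (cong (combo es) (coefficients-⊕ us x y)) (combo-⊕ es _ _)

coefficients-false∷ : ∀ {n s} (us : Vec (V n) s) b x → coefficients (Vec.map (false ∷_) us) (b ∷ x) ≡ coefficients us x
coefficients-false∷ us b x = sym (Vecₚ.map-∘ (λ u → dot u (b ∷ x)) (false ∷_) us)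

coefficients-lift : ∀ {n s} (us : Vec (V n) s) z b x →
  coefficients (Vec.map (λ u → dot u z ∷ u) us) (b ∷ x) ≡ coefficients us (x ⊕ (if b then z else 𝟎))
coefficients-lift []       z b x = refl
coefficients-lift (u ∷ us) z b x = cong₂ _∷_ (lifted b) (coefficients-lift us z b x)
  where
  lifted : ∀ b → (dot u z ∧ b) xor dot u x ≡ dot u (x ⊕ (if b then z else 𝟎))
  lifted true  = trans (cong (_xor dot u x) (∧-identityʳ (dot u z)))
                       (trans (xor-comm (dot u z) (dot u x)) (sym (dot-⊕ʳ u x z)))
  lifted false = trans (cong (_xor dot u x) (∧-zeroʳ (dot u z))) (cong (dot u) (sym (⊕-identityʳ x)))

combo-false∷ : ∀ {n s} (es : Vec (V n) s) c → combo (Vec.map (false ∷_) es) c ≡ false ∷ combo es c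
combo-false∷ []       []          = refl
combo-false∷ (e ∷ es) (true ∷ c)  = cong ((false ∷ e) ⊕_) (combo-false∷ es c)
combo-false∷ (e ∷ es) (false ∷ c) = cong ((false ∷ 𝟎) ⊕_) (combo-false∷ es c)

record Retraction {n} (P : V n → Bool) (t : ℕ) : Set where
  field
    rank     : ℕ
    rank+t≤n : rank + t ≤ n
    us es    : Vec (V n) rank
    lands    : ∀ x → P (x ⊕ lowRank us es x) ≡ true

Retraction-mono : ∀ {n t t′} {P : V n → Bool} → t ≤ t′ → Retraction P t′ → Retraction P t
Retraction-mono t≤t′ R = record
  { rank = rank ; rank+t≤n = ≤-trans (+-monoʳ-≤ rank t≤t′) rank+t≤n ; us = us ; es = es ; lands = lands }
  where open Retraction R

Retraction-extend : ∀ {n t} {P : V (suc n) → Bool} → Retraction (P ∘ (false ∷_)) t → Retraction P t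
Retraction-extend {P = P} R₀ = record
  { rank     = suc rank
  ; rank+t≤n = s≤s rank+t≤n
  ; us       = (true ∷ 𝟎) ∷ Vec.map (false ∷_) us
  ; es       = (true ∷ 𝟎) ∷ Vec.map (false ∷_) es
  ; lands    = λ { (b ∷ x) → subst (λ v → P v ≡ true) (sym (extended b x)) (lands x) }
  }
  where
  open Retraction R₀
  extended : ∀ b x → (b ∷ x) ⊕ ((if b xor dot 𝟎 x then true ∷ 𝟎 else 𝟎)
                                 ⊕ combo (Vec.map (false ∷_) es) (coefficients (Vec.map (false ∷_) us) (b ∷ x)))
                   ≡ false ∷ (x ⊕ lowRank us es x)
  extended b x rewrite dot-𝟎ˡ x | xor-identityʳ b | coefficients-false∷ us b x | combo-false∷ es (coefficients us x)
    with b
  ... | true  = cong (λ v → false ∷ (x ⊕ v)) (⊕-identityˡ (lowRank us es x))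
  ... | false = cong (λ v → false ∷ (x ⊕ v)) (⊕-identityˡ (lowRank us es x))

Retraction-halve : ∀ {n t} {P : V (suc n) → Bool} → Closed P → ∀ z → P (true ∷ z) ≡ true →
  Retraction (P ∘ (false ∷_)) t → Retraction P (suc t)
Retraction-halve {t = t} {P} closed z z∈ R₀ = record
  { rank     = rank
  ; rank+t≤n = ≤-trans (≤-reflexive (+-suc rank t)) (s≤s rank+t≤n)
  ; us       = Vec.map (λ u → dot u z ∷ u) us
  ; es       = Vec.map (false ∷_) es
  ; lands    = λ { (b ∷ x) → subst (λ v → P ((b ∷ x) ⊕ v) ≡ true)
                     (sym (trans (combo-false∷ es _) (cong (λ c → false ∷ combo es c) (coefficients-lift us z b x))))
                     (lifted b x) }
  }
  where
  open Retraction R₀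
  lifted : ∀ b x → P ((b ∷ x) ⊕ (false ∷ lowRank us es (x ⊕ (if b then z else 𝟎)))) ≡ true
  lifted false x = subst (λ v → P (false ∷ (x ⊕ lowRank us es v)) ≡ true) (sym (⊕-identityʳ x)) (lands x)
  lifted true  x = subst (λ v → P (true ∷ v) ≡ true) (rearrange (lowRank us es (x ⊕ z))) (closed (lands (x ⊕ z)) z∈)
    where
    rearrange : ∀ e → ((x ⊕ z) ⊕ e) ⊕ z ≡ x ⊕ e
    rearrange e = begin
      ((x ⊕ z) ⊕ e) ⊕ z   ≡⟨ cong (_⊕ z) (⊕-assoc x z e) ⟩
      (x ⊕ (z ⊕ e)) ⊕ z   ≡⟨ cong (λ v → (x ⊕ v) ⊕ z) (⊕-comm z e) ⟩
      (x ⊕ (e ⊕ z)) ⊕ z   ≡⟨ cong (_⊕ z) (⊕-assoc x e z) ⟨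
      ((x ⊕ e) ⊕ z) ⊕ z   ≡⟨ ⊕-cancelʳ (x ⊕ e) z ⟩
      x ⊕ e               ∎
      where open ≡-Reasoning

-- If no vector of P starts with 1, P sits in the lower half and one rank is spent on the first coordinate;
-- otherwise translation by some (1 ∷ z) ∈ P matches the two halves, so the lower half has half the size.
retraction : ∀ n {t} (P : V n → Bool) → Closed P → 2 ^ t ≤ Σᵥ n (ind ∘ P) → Retraction P t
retraction zero {t} P closed big with P [] in P[]
... | true  = record { rank = 0 ; rank+t≤n = pow₂-cancel-≤ big ; us = [] ; es = [] ; lands = λ { [] → P[] } }
... | false = ⊥-elim (<⇒≱ (m^n>0 2 t) big)
retraction (suc n) {t} P closed big with any (P ∘ (true ∷_)) (allVecs n) in found
... | false = Retraction-extend (retraction n P₀ closed (≤-trans big (≤-reflexive lower-half-only)))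
  where
  P₀ = P ∘ (false ∷_)
  lower-half-only : Σᵥ (suc n) (ind ∘ P) ≡ Σᵥ n (ind ∘ P₀)
  lower-half-only = begin
    Σᵥ n (ind ∘ P₀) + Σᵥ n (λ x → ind (P (true ∷ x)))
      ≡⟨ cong (Σᵥ n (ind ∘ P₀) +_) (Σᵥ-cong n (λ x → cong ind (any-allVecs-false n (P ∘ (true ∷_)) found x))) ⟩
    Σᵥ n (ind ∘ P₀) + Σᵥ n (λ _ → 0)   ≡⟨ cong (Σᵥ n (ind ∘ P₀) +_) (trans (Σᵥ-const n 0) (*-zeroʳ (2 ^ n))) ⟩
    Σᵥ n (ind ∘ P₀) + 0                ≡⟨ +-identityʳ _ ⟩
    Σᵥ n (ind ∘ P₀)                    ∎
    where open ≡-Reasoning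
... | true with any-allVecs⁻ n (P ∘ (true ∷_)) found
...   | z , z∈ = Retraction-mono (t≤suc[pred[t]] t)
                   (Retraction-halve closed z z∈ (retraction n P₀ closed (pow₂-halve t (≤-trans big (≤-reflexive doubled)))))
  where
  P₀ = P ∘ (false ∷_)
  t≤suc[pred[t]] : ∀ t → t ≤ suc (pred t)
  t≤suc[pred[t]] zero    = z≤n
  t≤suc[pred[t]] (suc t) = ≤-refl
  upper≡lower : ∀ x → P (true ∷ x) ≡ P₀ (x ⊕ z)
  upper≡lower x = ⇔→≡ (mk⇔ (λ x∈ → closed x∈ z∈)
    (λ x⊕z∈ → subst (λ v → P (true ∷ v) ≡ true) (⊕-cancelʳ x z) (closed x⊕z∈ z∈)))
  doubled : Σᵥ (suc n) (ind ∘ P) ≡ 2 * Σᵥ n (ind ∘ P₀)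
  doubled = begin
    Σᵥ n (ind ∘ P₀) + Σᵥ n (λ x → ind (P (true ∷ x)))
      ≡⟨ cong (Σᵥ n (ind ∘ P₀) +_) (Σᵥ-cong n (cong ind ∘ upper≡lower)) ⟩
    Σᵥ n (ind ∘ P₀) + Σᵥ n (λ x → ind (P₀ (x ⊕ z)))
      ≡⟨ cong (Σᵥ n (ind ∘ P₀) +_) (trans (Σᵥ-translate n (ind ∘ P₀) z) (sym (+-identityʳ _))) ⟩
    2 * Σᵥ n (ind ∘ P₀) ∎
    where open ≡-Reasoning


record BilinearForm {n} (β : V n → V n → Bool) : Set where
  field
    additiveˡ : ∀ x x′ y → β (x ⊕ x′) y ≡ β x y xor β x′ y
    additiveʳ : ∀ x y y′ → β x (y ⊕ y′) ≡ β x y xor β x y′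

BilinearForm-flip : ∀ {n} {β : V n → V n → Bool} → BilinearForm β → BilinearForm (flip β)
BilinearForm-flip bil = record { additiveˡ = λ x x′ y → additiveʳ y x x′ ; additiveʳ = λ x y y′ → additiveˡ y y′ x }
  where open BilinearForm bil

BilinearForm-precompose : ∀ {n} {β : V n → V n → Bool} → BilinearForm β →
  (f : V n → V n) → (∀ x y → f (x ⊕ y) ≡ f x ⊕ f y) → BilinearForm (λ x y → β (f x) y)
BilinearForm-precompose {β = β} bil f f-add = record
  { additiveˡ = λ x x′ y → trans (cong (λ v → β v y) (f-add x x′)) (additiveˡ (f x) (f x′) y)
  ; additiveʳ = λ x → additiveʳ (f x)
  }
  where open BilinearForm bil

lamDot-bilinear : ∀ {n r} {α : V n → V n → V r} → Bilinear α → ∀ l → BilinearForm (lamDot l α)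
lamDot-bilinear (α-additiveˡ , α-additiveʳ) l = record
  { additiveˡ = λ x x′ y → trans (cong (dot l) (α-additiveˡ x x′ y)) (dot-⊕ʳ l _ _)
  ; additiveʳ = λ x y y′ → trans (cong (dot l) (α-additiveʳ x y y′)) (dot-⊕ʳ l _ _)
  }

sumProd-flip : ∀ {n s} (us vs : Vec (V n) s) x y → sumProd us vs x y ≡ sumProd vs us y x
sumProd-flip []       []       x y = refl
sumProd-flip (u ∷ us) (v ∷ vs) x y = cong₂ _xor_ (∧-comm (dot u x) (dot v y)) (sumProd-flip us vs x y)

sumProd-++ : ∀ {n s₁ s₂} (us₁ vs₁ : Vec (V n) s₁) (us₂ vs₂ : Vec (V n) s₂) x y →
  sumProd (us₁ ++ us₂) (vs₁ ++ vs₂) x y ≡ sumProd us₁ vs₁ x y xor sumProd us₂ vs₂ x y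
sumProd-++ []         []         us₂ vs₂ x y = refl
sumProd-++ (u ∷ us₁) (v ∷ vs₁) us₂ vs₂ x y =
  trans (cong ((dot u x ∧ dot v y) xor_) (sumProd-++ us₁ vs₁ us₂ vs₂ x y))
        (sym (xor-assoc (dot u x ∧ dot v y) (sumProd us₁ vs₁ x y) (sumProd us₂ vs₂ x y)))

HasDecomp-cong : ∀ {n s} {β β′ : V n → V n → Bool} → (∀ x y → β x y ≡ β′ x y) → HasDecomp β′ s → HasDecomp β s
HasDecomp-cong β≡β′ (us , vs , β′≡) = us , vs , λ x y → trans (β≡β′ x y) (β′≡ x y)

HasDecomp-flip : ∀ {n s} {β : V n → V n → Bool} → HasDecomp β s → HasDecomp (flip β) s
HasDecomp-flip (us , vs , β≡) = vs , us , λ x y → trans (β≡ y x) (sumProd-flip us vs y x)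

HasDecomp-xor : ∀ {n s₁ s₂} {β₁ β₂ : V n → V n → Bool} → HasDecomp β₁ s₁ → HasDecomp β₂ s₂ →
  HasDecomp (λ x y → β₁ x y xor β₂ x y) (s₁ + s₂)
HasDecomp-xor (us₁ , vs₁ , β₁≡) (us₂ , vs₂ , β₂≡) =
  us₁ ++ us₂ , vs₁ ++ vs₂ , λ x y → trans (cong₂ _xor_ (β₁≡ x y) (β₂≡ x y)) (sym (sumProd-++ us₁ vs₁ us₂ vs₂ x y))

-- Each eᵢ contributes the product of the linear forms uᵢ · x and β eᵢ y.
HasDecomp-lowRankˡ : ∀ {n s} {β : V n → V n → Bool} → BilinearForm β →
  (us es : Vec (V n) s) → HasDecomp (λ x y → β (lowRank us es x) y) s
HasDecomp-lowRankˡ {n} {β = β} bil us es = us , Vec.map (represent ∘ β) es , expand us es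
  where
  open BilinearForm bil
  β𝟎 : ∀ y → β 𝟎 y ≡ false
  β𝟎 y = additive-𝟎 (λ v → β v y) (λ v v′ → additiveˡ v v′ y)
  scaled : ∀ c e y → β (if c then e else 𝟎) y ≡ c ∧ dot (represent (β e)) y
  scaled true  e y = sym (dot-represent (β e) (additiveʳ e) y)
  scaled false e y = β𝟎 y
  expand : ∀ {s} (us es : Vec (V n) s) x y → β (lowRank us es x) y ≡ sumProd us (Vec.map (represent ∘ β) es) x y
  expand []       []       x y = β𝟎 y
  expand (u ∷ us) (e ∷ es) x y =
    trans (additiveˡ (if dot u x then e else 𝟎) (lowRank us es x) y)
          (cong₂ _xor_ (scaled (dot u x) e y) (expand us es x y))

HasDecomp-lowRankʳ : ∀ {n s} {β : V n → V n → Bool} → BilinearForm β →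
  (us es : Vec (V n) s) → HasDecomp (λ x y → β x (lowRank us es y)) s
HasDecomp-lowRankʳ bil us es = HasDecomp-flip (HasDecomp-lowRankˡ (BilinearForm-flip bil) us es)

annihilates : ∀ {n k} → (V n → V n → Bool) → Vec (V n) k → V n → Bool
annihilates {k = k} β bs x = not (any (λ c → β x (combo bs c)) (allVecs k))

annihilates-intro : ∀ {n k} (β : V n → V n → Bool) (bs : Vec (V n) k) {x} →
  (∀ c → β x (combo bs c) ≡ false) → annihilates β bs x ≡ true
annihilates-intro {k = k} β bs none = cong not (any-allVecs-none k _ none)

annihilates-elim : ∀ {n k} (β : V n → V n → Bool) (bs : Vec (V n) k) {x} →
  annihilates β bs x ≡ true → ∀ c → β x (combo bs c) ≡ false
annihilates-elim {k = k} β bs x∈ = any-allVecs-false k _ (not-injective {y = false} x∈)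

annihilates-witness : ∀ {n k} (β : V n → V n → Bool) (bs : Vec (V n) k) {x} →
  annihilates β bs x ≡ false → ∃ λ c → β x (combo bs c) ≡ true
annihilates-witness {k = k} β bs x∉ = any-allVecs⁻ k _ (not-injective {y = true} x∉)

annihilates-closed : ∀ {n k} {β : V n → V n → Bool} → BilinearForm β → (bs : Vec (V n) k) → Closed (annihilates β bs)
annihilates-closed {β = β} bil bs {x} {y} x∈ y∈ = annihilates-intro β bs λ c →
  trans (BilinearForm.additiveˡ bil x y (combo bs c)) (cong₂ _xor_ (annihilates-elim β bs x∈ c) (annihilates-elim β bs y∈ c))

annihilates-𝟎 : ∀ {n k} {β : V n → V n → Bool} → BilinearForm β → (bs : Vec (V n) k) → annihilates β bs 𝟎 ≡ true
annihilates-𝟎 {β = β} bil bs = annihilates-intro β bs λ c →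
  additive-𝟎 (λ v → β v (combo bs c)) (λ v v′ → BilinearForm.additiveˡ bil v v′ (combo bs c))

-- With x′ = x + E x annihilating span bs and y + F y ∈ span bs: β x y = β (E x) y + β x′ (F y).
HasDecomp-retractions : ∀ {n k t₁ t₂} {β : V n → V n → Bool} → BilinearForm β → (bs : Vec (V n) k) →
  (R₁ : Retraction (annihilates β bs) t₁) (R₂ : Retraction (inSpan bs) t₂) →
  HasDecomp β (Retraction.rank R₁ + Retraction.rank R₂)
HasDecomp-retractions {n} {β = β} bil bs R₁ R₂ =
  HasDecomp-cong split
    (HasDecomp-xor (HasDecomp-lowRankˡ bil (us R₁) (es R₁))
                   (HasDecomp-lowRankʳ (BilinearForm-precompose bil retract retract-⊕) (us R₂) (es R₂)))
  where
  open Retraction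
  open BilinearForm bil
  E = lowRank (us R₁) (es R₁)
  F = lowRank (us R₂) (es R₂)
  retract : V n → V n
  retract x = x ⊕ E x
  retract-⊕ : ∀ x y → retract (x ⊕ y) ≡ retract x ⊕ retract y
  retract-⊕ x y = trans (cong ((x ⊕ y) ⊕_) (lowRank-⊕ (us R₁) (es R₁) x y)) (⊕-interchange x y (E x) (E y))
  split : ∀ x y → β x y ≡ β (E x) y xor β (retract x) (F y)
  split x y = begin
    β x y                                          ≡⟨ cong (λ v → β v y) (⊕-cancelʳ x (E x)) ⟨
    β (retract x ⊕ E x) y                          ≡⟨ additiveˡ (retract x) (E x) y ⟩
    β (retract x) y xor β (E x) y                  ≡⟨ xor-comm (β (retract x) y) (β (E x) y) ⟩
    β (E x) y xor β (retract x) y                  ≡⟨ cong (λ v → β (E x) y xor β (retract x) v) (⊕-cancelʳ y (F y)) ⟨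
    β (E x) y xor β (retract x) ((y ⊕ F y) ⊕ F y)  ≡⟨ cong (β (E x) y xor_) (additiveʳ (retract x) (y ⊕ F y) (F y)) ⟩
    β (E x) y xor (β (retract x) (y ⊕ F y) xor β (retract x) (F y))
      ≡⟨ cong (λ b → β (E x) y xor (b xor β (retract x) (F y))) annihilated ⟩
    β (E x) y xor β (retract x) (F y)              ∎
    where
    open ≡-Reasoning
    annihilated : β (retract x) (y ⊕ F y) ≡ false
    annihilated with inSpan⁻ bs (lands R₂ y)
    ... | c , c↦ = subst (λ w → β (retract x) w ≡ false) c↦ (annihilates-elim β bs (lands R₁ x) c)

module _ {n d m} {β : V n → V n → Bool} (bil : BilinearForm β) (rank≥m : RankAtLeast β m)
         (d≤n : d ≤ n) (bs : Vec (V n) (n ∸ d)) (indep : LinIndep bs) where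

  -- Retractions onto the annihilator and onto span bs decompose β into at most (n - t) + d terms.
  annihilator-dimension : ∀ {t} → 2 ^ t ≤ Σᵥ n (ind ∘ annihilates β bs) → t + m ≤ n + d
  annihilator-dimension {t} big = begin
    t + m           ≤⟨ +-monoʳ-≤ t (rank≥m (r₁ + r₂) (HasDecomp-retractions bil bs R₁ R₂)) ⟩
    t + (r₁ + r₂)   ≡⟨ +-assoc t r₁ r₂ ⟨
    t + r₁ + r₂     ≡⟨ cong (_+ r₂) (+-comm t r₁) ⟩
    r₁ + t + r₂     ≤⟨ +-mono-≤ (Retraction.rank+t≤n R₁) r₂≤d ⟩
    n + d           ∎
    where
    open ≤-Reasoning
    R₁ = retraction n (annihilates β bs) (annihilates-closed bil bs) big
    R₂ = retraction n (inSpan bs) (inSpan-⊕ bs) (span-size bs indep)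
    r₁ = Retraction.rank R₁
    r₂ = Retraction.rank R₂
    r₂≤d : r₂ ≤ d
    r₂≤d = +-cancelʳ-≤ (n ∸ d) r₂ d (≤-trans (Retraction.rank+t≤n R₂) (≤-reflexive (sym (m+[n∸m]≡n d≤n))))

  annihilator-bound : 2 ^ m * Σᵥ n (ind ∘ annihilates β bs) ≤ 2 ^ suc (n + d)
  annihilator-bound = bounded (binary-magnitude (suc n) K 1≤K K<2^[1+n])
    where
    open ≤-Reasoning
    K = Σᵥ n (ind ∘ annihilates β bs)
    1≤K : 1 ≤ K
    1≤K = ≤-trans (≤-reflexive (cong ind (sym (annihilates-𝟎 bil bs)))) (term≤Σᵥ n (ind ∘ annihilates β bs) 𝟎)
    K<2^[1+n] : K < 2 ^ suc n
    K<2^[1+n] = ≤-<-trans (Σᵥ-ind≤ n (annihilates β bs)) (^-monoʳ-< 2 (s≤s (s≤s z≤n)) (n<1+n n))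
    bounded : (∃ λ t → 2 ^ t ≤ K × K < 2 ^ suc t) → 2 ^ m * K ≤ 2 ^ suc (n + d)
    bounded (t , 2^t≤K , K<2^[1+t]) = begin
      2 ^ m * K           ≤⟨ *-monoʳ-≤ (2 ^ m) (<⇒≤ K<2^[1+t]) ⟩
      2 ^ m * 2 ^ suc t   ≡⟨ ^-distribˡ-+-* 2 m (suc t) ⟨
      2 ^ (m + suc t)     ≤⟨ ^-monoʳ-≤ 2 exponent ⟩
      2 ^ suc (n + d)     ∎
      where
      exponent : m + suc t ≤ suc (n + d)
      exponent = ≤-trans (≤-reflexive (trans (+-suc m t) (cong suc (+-comm m t)))) (s≤s (annihilator-dimension 2^t≤K))

annihilating : ∀ {n r k} → (V n → V n → V r) → Vec (V n) k → V n → ℕ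
annihilating {r = r} α bs x = Σᵥ r (λ l → ind (not ⌊ l ≟V 𝟎 ⌋ ∧ annihilates (lamDot l α) bs x))

annihilating-total : ∀ {n r d m} {α : V n → V n → V r} → Bilinear α →
  (∀ l → l ≢ 𝟎 → RankAtLeast (lamDot l α) m) → d ≤ n → (bs : Vec (V n) (n ∸ d)) → LinIndep bs →
  2 ^ m * Σᵥ n (annihilating α bs) ≤ 2 ^ r * 2 ^ suc (n + d)
annihilating-total {n} {r} {d} {m} {α} bil rank≥m d≤n bs indep = begin
  2 ^ m * Σᵥ n (annihilating α bs)            ≡⟨ cong (2 ^ m *_) (Σᵥ-swap n r _) ⟩
  2 ^ m * Σᵥ r (λ l → Σᵥ n (f l))             ≡⟨ Σᵥ-*ˡ r (2 ^ m) (λ l → Σᵥ n (f l)) ⟨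
  Σᵥ r (λ l → 2 ^ m * Σᵥ n (f l))             ≤⟨ Σᵥ-mono r bounded ⟩
  Σᵥ r (λ _ → 2 ^ suc (n + d))                ≡⟨ Σᵥ-const r (2 ^ suc (n + d)) ⟩
  2 ^ r * 2 ^ suc (n + d)                     ∎
  where
  open ≤-Reasoning
  f : V r → V n → ℕ
  f l x = ind (not ⌊ l ≟V 𝟎 ⌋ ∧ annihilates (lamDot l α) bs x)
  bounded : ∀ l → 2 ^ m * Σᵥ n (f l) ≤ 2 ^ suc (n + d)
  bounded l with l ≟V 𝟎
  ... | yes _   = ≤-trans (≤-reflexive (trans (cong (2 ^ m *_) (trans (Σᵥ-const n 0) (*-zeroʳ (2 ^ n)))) (*-zeroʳ (2 ^ m)))) z≤n
  ... | no l≢𝟎 = annihilator-bound (lamDot-bilinear bil l) (rank≥m l l≢𝟎) d≤n bs indep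


-- Counting pairs by characters

module Counting {n r k} (α : V n → V n → V r) (bil : Bilinear α) (bs : Vec (V n) k) (a : V n) (u : V r) where

  inC : V n → Bool
  inC = inCoset bs a

  |C| : ℕ
  |C| = Σᵥ n (ind ∘ inC)

  hits : V n → ℕ
  hits x = Σᵥ n (λ y → ind (inC y ∧ ⌊ α x y ≟V u ⌋))

  agreements : V n → V r → ℕ
  agreements x l = Σᵥ n (λ y → ind (inC y ∧ not (dot l (α x y ⊕ u))))

  Σ-agreements : ∀ x → Σᵥ r (λ l → 2 * agreements x l) ≡ 2 ^ r * |C| + 2 ^ r * hits x
  Σ-agreements x = begin
    Σᵥ r (λ l → 2 * agreements x l)
      ≡⟨ Σᵥ-cong r (λ l → Σᵥ-*ˡ n 2 (λ y → term l y)) ⟨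
    Σᵥ r (λ l → Σᵥ n (λ y → 2 * term l y))
      ≡⟨ Σᵥ-swap r n (λ l y → 2 * term l y) ⟩
    Σᵥ n (λ y → Σᵥ r (λ l → 2 * term l y))
      ≡⟨ Σᵥ-cong n pointwise ⟩
    Σᵥ n (λ y → 2 ^ r * ind (inC y) + 2 ^ r * ind (inC y ∧ ⌊ α x y ≟V u ⌋))
      ≡⟨ Σᵥ-+ n (λ y → 2 ^ r * ind (inC y)) (λ y → 2 ^ r * ind (inC y ∧ ⌊ α x y ≟V u ⌋)) ⟩
    Σᵥ n (λ y → 2 ^ r * ind (inC y)) + Σᵥ n (λ y → 2 ^ r * ind (inC y ∧ ⌊ α x y ≟V u ⌋))
      ≡⟨ cong₂ _+_ (Σᵥ-*ˡ n (2 ^ r) (ind ∘ inC)) (Σᵥ-*ˡ n (2 ^ r) (λ y → ind (inC y ∧ ⌊ α x y ≟V u ⌋))) ⟩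
    2 ^ r * |C| + 2 ^ r * hits x ∎
    where
    open ≡-Reasoning
    term : V r → V n → ℕ
    term l y = ind (inC y ∧ not (dot l (α x y ⊕ u)))
    pointwise : ∀ y → Σᵥ r (λ l → 2 * term l y) ≡ 2 ^ r * ind (inC y) + 2 ^ r * ind (inC y ∧ ⌊ α x y ≟V u ⌋)
    pointwise y with inC y
    ... | true  = trans (Σᵥ-character r (α x y) u) (cong (_+ 2 ^ r * ind ⌊ α x y ≟V u ⌋) (sym (*-identityʳ (2 ^ r))))
    ... | false = trans (Σᵥ-const r 0) (trans (*-zeroʳ (2 ^ r)) (sym (cong₂ _+_ (*-zeroʳ (2 ^ r)) (*-zeroʳ (2 ^ r)))))

  -- For l ≠ 0 with some w ∈ span bs and l · α(x, w) = 1, translating by w swaps agreements and disagreements.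
  agreements-bound : ∀ x l → |C| + |C| * ind ⌊ l ≟V 𝟎 ⌋ ≤
    2 * agreements x l + |C| * ind (not ⌊ l ≟V 𝟎 ⌋ ∧ annihilates (lamDot l α) bs x)
  agreements-bound x l with l ≟V 𝟎
  ... | yes refl = ≤-reflexive (begin-equality
    |C| + |C| * 1                   ≡⟨ solve 1 (λ c → c :+ c :* con 1 := con 2 :* c :+ c :* con 0) refl |C| ⟩
    2 * |C| + |C| * 0               ≡⟨ cong (λ c → 2 * c + |C| * 0) all-agree ⟨
    2 * agreements x 𝟎 + |C| * 0    ∎)
    where
    open ≤-Reasoning
    all-agree : agreements x 𝟎 ≡ |C|
    all-agree = Σᵥ-cong n (λ y → trans (cong (λ b → ind (inC y ∧ not b)) (dot-𝟎ˡ (α x y ⊕ u))) (cong ind (∧-identityʳ (inC y))))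
  ... | no _ with annihilates (lamDot l α) bs x in ann
  ...   | true  = ≤-trans (≤-reflexive (trans (cong (|C| +_) (*-zeroʳ |C|)) (trans (+-identityʳ |C|) (sym (*-identityʳ |C|)))))
                          (m≤n+m (|C| * 1) (2 * agreements x l))
  ...   | false with annihilates-witness (lamDot l α) bs ann
  ...     | c , flips = ≤-reflexive (cong (_+ |C| * 0) (sym balanced))
    where
    w = combo bs c
    flip-sign : ∀ y → dot l (α x (y ⊕ w) ⊕ u) ≡ not (dot l (α x y ⊕ u))
    flip-sign y = begin
      dot l (α x (y ⊕ w) ⊕ u)             ≡⟨ cong (λ v → dot l (v ⊕ u)) (proj₂ bil x y w) ⟩
      dot l ((α x y ⊕ α x w) ⊕ u)         ≡⟨ cong (λ v → dot l (v ⊕ u)) (⊕-comm (α x y) (α x w)) ⟩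
      dot l ((α x w ⊕ α x y) ⊕ u)         ≡⟨ cong (dot l) (⊕-assoc (α x w) (α x y) u) ⟩
      dot l (α x w ⊕ (α x y ⊕ u))         ≡⟨ dot-⊕ʳ l (α x w) (α x y ⊕ u) ⟩
      dot l (α x w) xor dot l (α x y ⊕ u) ≡⟨ cong (_xor dot l (α x y ⊕ u)) flips ⟩
      not (dot l (α x y ⊕ u))             ∎
      where open ≡-Reasoning
    balanced : 2 * agreements x l ≡ |C|
    balanced = Σᵥ-balanced n inC (λ y → dot l (α x y ⊕ u)) w (inCoset-shift bs a (inSpan⁺ bs c)) flip-sign

  hits-bound : ∀ x → |C| ≤ 2 ^ r * hits x + |C| * annihilating α bs x
  hits-bound x = +-cancelˡ-≤ (2 ^ r * |C|) |C| (2 ^ r * hits x + |C| * annihilating α bs x) (begin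
    2 ^ r * |C| + |C|
      ≤⟨ +-monoʳ-≤ (2 ^ r * |C|) (≤-trans (≤-reflexive (sym (*-identityʳ |C|))) (*-monoʳ-≤ |C| origin)) ⟩
    2 ^ r * |C| + |C| * Σᵥ r isOrigin
      ≡⟨ cong₂ _+_ (Σᵥ-const r |C|) (Σᵥ-*ˡ r |C| isOrigin) ⟨
    Σᵥ r (λ _ → |C|) + Σᵥ r (λ l → |C| * isOrigin l)
      ≡⟨ Σᵥ-+ r (λ _ → |C|) (λ l → |C| * isOrigin l) ⟨
    Σᵥ r (λ l → |C| + |C| * isOrigin l)
      ≤⟨ Σᵥ-mono r (agreements-bound x) ⟩
    Σᵥ r (λ l → 2 * agreements x l + |C| * degenerate l)
      ≡⟨ Σᵥ-+ r (λ l → 2 * agreements x l) (λ l → |C| * degenerate l) ⟩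
    Σᵥ r (λ l → 2 * agreements x l) + Σᵥ r (λ l → |C| * degenerate l)
      ≡⟨ cong₂ _+_ (Σ-agreements x) (Σᵥ-*ˡ r |C| degenerate) ⟩
    2 ^ r * |C| + 2 ^ r * hits x + |C| * annihilating α bs x
      ≡⟨ +-assoc (2 ^ r * |C|) (2 ^ r * hits x) (|C| * annihilating α bs x) ⟩
    2 ^ r * |C| + (2 ^ r * hits x + |C| * annihilating α bs x) ∎)
    where
    open ≤-Reasoning
    isOrigin : V r → ℕ
    isOrigin l = ind ⌊ l ≟V 𝟎 ⌋
    degenerate : V r → ℕ
    degenerate l = ind (not ⌊ l ≟V 𝟎 ⌋ ∧ annihilates (lamDot l α) bs x)
    origin : 1 ≤ Σᵥ r isOrigin
    origin = ≤-trans (≤-reflexive (cong ind (sym (≟V-complete refl)))) (term≤Σᵥ r isOrigin 𝟎)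

  pairCount-as-sum : pairCount α bs a u ≡ Σᵥ n (λ x → ind (inC x) * hits x)
  pairCount-as-sum = trans (count-allVecs² n _) (Σᵥ-cong n λ x →
    trans (Σᵥ-cong n (λ y → ind-∧ (inC x) (inC y ∧ ⌊ α x y ≟V u ⌋)))
          (Σᵥ-*ˡ n (ind (inC x)) (λ y → ind (inC y ∧ ⌊ α x y ≟V u ⌋))))

  pairCount-lower : |C| * |C| ≤ 2 ^ r * pairCount α bs a u + |C| * Σᵥ n (annihilating α bs)
  pairCount-lower = begin
    |C| * |C|                                       ≡⟨ Σᵥ-*ˡ n |C| (ind ∘ inC) ⟨
    Σᵥ n (λ x → |C| * ind (inC x))                  ≤⟨ Σᵥ-mono n pointwise ⟩
    Σᵥ n (λ x → 2 ^ r * (ind (inC x) * hits x) + |C| * annihilating α bs x)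
      ≡⟨ Σᵥ-+ n (λ x → 2 ^ r * (ind (inC x) * hits x)) (λ x → |C| * annihilating α bs x) ⟩
    Σᵥ n (λ x → 2 ^ r * (ind (inC x) * hits x)) + Σᵥ n (λ x → |C| * annihilating α bs x)
      ≡⟨ cong₂ _+_ (Σᵥ-*ˡ n (2 ^ r) (λ x → ind (inC x) * hits x)) (Σᵥ-*ˡ n |C| (annihilating α bs)) ⟩
    2 ^ r * Σᵥ n (λ x → ind (inC x) * hits x) + |C| * Σᵥ n (annihilating α bs)
      ≡⟨ cong (λ P → 2 ^ r * P + |C| * Σᵥ n (annihilating α bs)) pairCount-as-sum ⟨
    2 ^ r * pairCount α bs a u + |C| * Σᵥ n (annihilating α bs) ∎
    where
    open ≤-Reasoning
    pointwise : ∀ x → |C| * ind (inC x) ≤ 2 ^ r * (ind (inC x) * hits x) + |C| * annihilating α bs x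
    pointwise x with inC x
    ... | true  = ≤-trans (≤-reflexive (*-identityʳ |C|))
                    (≤-trans (hits-bound x) (≤-reflexive (cong (λ h → 2 ^ r * h + |C| * annihilating α bs x) (sym (+-identityʳ (hits x))))))
    ... | false = ≤-trans (≤-reflexive (*-zeroʳ |C|)) z≤n

pairCount-witness : ∀ {n r k} (α : V n → V n → V r) (bs : Vec (V n) k) (a : V n) (u : V r) → 1 ≤ pairCount α bs a u →
  Σ (V n) λ x → Σ (V n) λ y → inCoset bs a x ≡ true × inCoset bs a y ≡ true × α x y ≡ u
pairCount-witness {n} α bs a u pos with count-witness hit (cartesianProduct (allVecs n) (allVecs n)) pos
  where
  hit : V n × V n → Bool
  hit (x , y) = inCoset bs a x ∧ inCoset bs a y ∧ ⌊ α x y ≟V u ⌋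
... | (x , y) , found with ∧-≡-true found
...   | x∈C , rest with ∧-≡-true rest
...     | y∈C , α≡u = x , y , x∈C , y∈C , ≟V-sound α≡u


fraction-bound : ∀ p q C R P S → p ≤ q → C * C ≤ R * P + C * S → q * S ≤ p * C → (q ∸ p) * (C * C) ≤ q * R * P
fraction-bound p q C R P S p≤q C²≤ qS≤pC = +-cancelʳ-≤ (p * (C * C)) ((q ∸ p) * (C * C)) (q * R * P) (begin
  (q ∸ p) * (C * C) + p * (C * C)   ≡⟨ *-distribʳ-+ (C * C) (q ∸ p) p ⟨
  (q ∸ p + p) * (C * C)             ≡⟨ cong (_* (C * C)) (m∸n+n≡m p≤q) ⟩
  q * (C * C)                       ≤⟨ *-monoʳ-≤ q C²≤ ⟩
  q * (R * P + C * S)               ≡⟨ solve 5 (λ q R P C S → q :* (R :* P :+ C :* S) := q :* R :* P :+ C :* (q :* S)) refl q R P C S ⟩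
  q * R * P + C * (q * S)           ≤⟨ +-monoʳ-≤ (q * R * P) (*-monoʳ-≤ C qS≤pC) ⟩
  q * R * P + C * (p * C)           ≡⟨ cong (q * R * P +_) (solve 2 (λ C p → C :* (p :* C) := p :* (C :* C)) refl C p) ⟩
  q * R * P + p * (C * C)           ∎)
  where open ≤-Reasoning

annihilating-vs-coset : ∀ {n d r m p q S C} → d ≤ n → q * 2 ^ suc (r + d + d) ≤ p * 2 ^ m →
  2 ^ m * S ≤ 2 ^ r * 2 ^ suc (n + d) → 2 ^ (n ∸ d) ≤ C → q * S ≤ p * C
annihilating-vs-coset {n} {d} {r} {m} {p} {q} {S} {C} d≤n ε-condition S≤ C≥ =
  *-cancelʳ-≤ (q * S) (p * C) (2 ^ m) {{m^n≢0 2 m}} (begin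
    q * S * 2 ^ m                               ≡⟨ *-assoc q S (2 ^ m) ⟩
    q * (S * 2 ^ m)                             ≡⟨ cong (q *_) (*-comm S (2 ^ m)) ⟩
    q * (2 ^ m * S)                             ≤⟨ *-monoʳ-≤ q S≤ ⟩
    q * (2 ^ r * 2 ^ suc (n + d))               ≡⟨ cong (q *_) exponents ⟩
    q * (2 ^ suc (r + d + d) * 2 ^ (n ∸ d))     ≡⟨ *-assoc q _ _ ⟨
    q * 2 ^ suc (r + d + d) * 2 ^ (n ∸ d)       ≤⟨ *-monoˡ-≤ (2 ^ (n ∸ d)) ε-condition ⟩
    p * 2 ^ m * 2 ^ (n ∸ d)                     ≤⟨ *-monoʳ-≤ (p * 2 ^ m) C≥ ⟩
    p * 2 ^ m * C                               ≡⟨ solve 3 (λ p M C → p :* M :* C := p :* C :* M) refl p (2 ^ m) C ⟩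
    p * C * 2 ^ m                               ∎)
  where
  open ≤-Reasoning
  e = n ∸ d
  exponents : 2 ^ r * 2 ^ suc (n + d) ≡ 2 ^ suc (r + d + d) * 2 ^ e
  exponents = begin-equality
    2 ^ r * 2 ^ suc (n + d)          ≡⟨ ^-distribˡ-+-* 2 r (suc (n + d)) ⟨
    2 ^ (r + suc (n + d))            ≡⟨ cong (λ n′ → 2 ^ (r + suc (n′ + d))) (m+[n∸m]≡n d≤n) ⟨
    2 ^ (r + suc (d + e + d))        ≡⟨ cong (2 ^_) (solve 3 (λ r d e → r :+ (con 1 :+ (d :+ e :+ d)) := con 1 :+ (r :+ d :+ d) :+ e) refl r d e) ⟩
    2 ^ (suc (r + d + d) + e)        ≡⟨ ^-distribˡ-+-* 2 (suc (r + d + d)) e ⟩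
    2 ^ suc (r + d + d) * 2 ^ e      ∎

ε-condition-from-threshold : ∀ {r d m p q} → 1 ≤ r → p ≤ q → q ^ 4 * 2 ^ (4 * r + 8 * d) < p ^ 4 * 2 ^ m →
  q * 2 ^ suc (r + d + d) ≤ p * 2 ^ m
ε-condition-from-threshold {r} {d} {m} {p} {q} 1≤r p≤q hyp = ≤-trans (*-monoʳ-≤ q (^-monoʳ-≤ 2 exponent)) (<⇒≤ qA<pM)
  where
  open ≤-Reasoning
  A = 4 * r + 8 * d
  q³ = q * q * q
  qA<pM : q * 2 ^ A < p * 2 ^ m
  qA<pM = *-cancelˡ-< q³ (q * 2 ^ A) (p * 2 ^ m) (begin-strict
    q³ * (q * 2 ^ A)      ≡⟨ solve 2 (λ q X → q :* q :* q :* (q :* X) := (q :* (q :* (q :* (q :* con 1)))) :* X) refl q (2 ^ A) ⟩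
    q ^ 4 * 2 ^ A         <⟨ hyp ⟩
    p ^ 4 * 2 ^ m         ≡⟨ solve 2 (λ p M → (p :* (p :* (p :* (p :* con 1)))) :* M := p :* p :* p :* p :* M) refl p (2 ^ m) ⟩
    p * p * p * p * 2 ^ m ≤⟨ *-monoˡ-≤ (2 ^ m) (*-monoˡ-≤ p (*-mono-≤ (*-mono-≤ p≤q p≤q) p≤q)) ⟩
    q³ * p * 2 ^ m        ≡⟨ *-assoc q³ p (2 ^ m) ⟩
    q³ * (p * 2 ^ m)      ∎)
  exponent : suc (r + d + d) ≤ A
  exponent = begin
    suc (r + d + d)                    ≤⟨ +-monoˡ-≤ d (+-monoˡ-≤ d (+-monoˡ-≤ r 1≤r)) ⟩
    r + r + d + d                      ≤⟨ m≤m+n (r + r + d + d) (2 * r + 6 * d) ⟩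
    r + r + d + d + (2 * r + 6 * d)    ≡⟨ solve 2 (λ r d → r :+ r :+ d :+ d :+ (con 2 :* r :+ con 6 :* d) := con 4 :* r :+ con 8 :* d) refl r d ⟩
    A                                  ∎

pairCount-bound : ∀ {n r m d} (α : V n → V n → V r) → Bilinear α →
  (∀ l → l ≢ 𝟎 → RankAtLeast (lamDot l α) m) →
  d ≤ n → (bs : Vec (V n) (n ∸ d)) → LinIndep bs → (a : V n) →
  ∀ {p q} → p ≤ q → q * 2 ^ suc (r + d + d) ≤ p * 2 ^ m →
  ∀ u → (q ∸ p) * (cosetSize bs a * cosetSize bs a) ≤ q * 2 ^ r * pairCount α bs a u
pairCount-bound {n} {r} {m} {d} α bil rank≥m d≤n bs indep a {p} {q} p≤q ε-condition u =
  subst (λ C → (q ∸ p) * (C * C) ≤ q * 2 ^ r * pairCount α bs a u) (sym (count-allVecs n (inCoset bs a)))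
    (fraction-bound p q |C| (2 ^ r) (pairCount α bs a u) S p≤q pairCount-lower
      (annihilating-vs-coset {n} {d} {r} {m} {p} {q} {S} {|C|} d≤n ε-condition
        (annihilating-total {r = r} bil rank≥m d≤n bs indep) (coset-size bs a indep)))
  where
  open Counting α bil bs a u
  S = Σᵥ n (annihilating α bs)

pairCount-density : ∀ {n r m d} → 1 ≤ r → (α : V n → V n → V r) → Bilinear α →
  (∀ l → l ≢ 𝟎 → RankAtLeast (lamDot l α) m) →
  d ≤ n → (bs : Vec (V n) (n ∸ d)) → LinIndep bs → (a : V n) →
  ∀ p q → q ^ 4 * 2 ^ (4 * r + 8 * d) < p ^ 4 * 2 ^ m →
  ∀ u → (q ∸ p) * (cosetSize bs a * cosetSize bs a) ≤ q * 2 ^ r * pairCount α bs a u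
pairCount-density {r = r} {m} {d} 1≤r α bil rank≥m d≤n bs indep a p q threshold u with q ≤? p
... | yes q≤p = subst (λ c → c * (cosetSize bs a * cosetSize bs a) ≤ q * 2 ^ r * pairCount α bs a u)
                      (sym (m≤n⇒m∸n≡0 q≤p)) z≤n
... | no  q≰p = pairCount-bound α bil rank≥m d≤n bs indep a p≤q (ε-condition-from-threshold {r} {d} {m} 1≤r p≤q threshold) u
  where p≤q = <⇒≤ (≰⇒> q≰p)

-- The case ε = 1/2 of the density bound leaves a pair for every u.
pairCount-surjective : ∀ {n r m d} → 1 ≤ r → (α : V n → V n → V r) → Bilinear α →
  (∀ l → l ≢ 𝟎 → RankAtLeast (lamDot l α) m) →
  d ≤ n → (bs : Vec (V n) (n ∸ d)) → LinIndep bs → (a : V n) → 4 * r + 8 * d + 4 < m →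
  ∀ u → Σ (V n) λ x → Σ (V n) λ y → inCoset bs a x ≡ true × inCoset bs a y ≡ true × α x y ≡ u
pairCount-surjective {n} {r} {m} {d} 1≤r α bil rank≥m d≤n bs indep a big u = pairCount-witness α bs a u 1≤pairCount
  where
  C = cosetSize bs a
  threshold : 2 ^ 4 * 2 ^ (4 * r + 8 * d) < 1 ^ 4 * 2 ^ m
  threshold = subst₂ _<_ (^-distribˡ-+-* 2 4 (4 * r + 8 * d)) (sym (*-identityˡ (2 ^ m)))
                     (^-monoʳ-< 2 (s≤s (s≤s z≤n)) (subst (_< m) (+-comm (4 * r + 8 * d) 4) big))
  1≤C : 1 ≤ C
  1≤C = ≤-trans (m^n>0 2 (n ∸ d)) (≤-trans (coset-size bs a indep) (≤-reflexive (sym (count-allVecs n (inCoset bs a)))))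
  halved : 1 * (C * C) ≤ 2 * 2 ^ r * pairCount α bs a u
  halved = pairCount-density 1≤r α bil rank≥m d≤n bs indep a 1 2 threshold u
  1≤pairCount : 1 ≤ pairCount α bs a u
  1≤pairCount = n≢0⇒n>0 λ pairCount≡0 → contradiction
    (≤-trans (*-monoʳ-≤ 1 (*-mono-≤ 1≤C 1≤C))
             (≤-trans halved (≤-reflexive (trans (cong (2 * 2 ^ r *_) pairCount≡0) (*-zeroʳ (2 * 2 ^ r))))))
    (λ ())

mainTheorem6 : (n r m d : ℕ) → 1 ≤ n → 1 ≤ r →
    (α : V n → V n → V r) → Bilinear α →
    (∀ (l : V r) → l ≢ 𝟎 → RankAtLeast (lamDot l α) m) →
    d ≤ n → (bs : Vec (V n) (n ∸ d)) → LinIndep bs → (a : V n) →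
    -- ε = p / q with p, q ≥ 1 ;  m > 4r + 8d + 4 log₂ ε⁻¹  ⇔  q⁴ 2^(4r+8d) < p⁴ 2^m
    ((p q : ℕ) → 1 ≤ p → 1 ≤ q →
       q ^ 4 * 2 ^ (4 * r + 8 * d) < p ^ 4 * 2 ^ m →
       ∀ (u : V r) →
         -- pairCount ≥ (1 - p/q) 2^(-r) |C|²
         (q ∸ p) * (cosetSize bs a * cosetSize bs a) ≤ q * 2 ^ r * pairCount α bs a u)
    ×
    (4 * r + 8 * d + 4 < m →
       ∀ (u : V r) → Σ (V n) λ x → Σ (V n) λ y →
         inCoset bs a x ≡ true × inCoset bs a y ≡ true × α x y ≡ u)
mainTheorem6 n r m d _ 1≤r α bil rank≥m d≤n bs indep a =
  (λ p q _ _ → pairCount-density 1≤r α bil rank≥m d≤n bs indep a p q) ,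
  pairCount-surjective 1≤r α bil rank≥m d≤n bs indep a
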